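{- Let $X\in\{BS\}\cup\{nS\mid n\geq 1\}$ and let $\varphi\in\mathcal{L}_X$. Then $\varphi$ is characteristic for some process modulo $\equiv_X$ if and only if $\varphi$ is satisfiable and, for all processes $p,q$ with $p\models\varphi$ and $q\models\varphi$, it holds that $p\equiv_X q$.
   Context: Processes are states of finite, loop-free labelled transition systems $(\mathtt{Proc},\mathtt{Act},\longrightarrow)$ over a finite non-empty set of actions $\mathtt{Act}$; loop-free means that $p\xrightarrow{t}p$ holds only for the empty trace $t$. The simulation preorder $\lesssim_S$ is the largest relation such that $p\lesssim_S q$ iff for every $p\xrightarrow{a}p'$ there is $q\xrightarrow{a}q'$ with $p'\lesssim_S q'$. Set $\lesssim_{1S}=\lesssim_S$; for $n>1$, $\lesssim_{nS}$ is the largest relation such that $p\lesssim_{nS}q$ iff (i) for every $p\xrightarrow{a}p'$ there is $q\xrightarrow{a}q'$ with $p'\lesssim_{nS}q'$, and (ii) $q\lesssim_{(n-1)S}p$. The equivalence $\equiv_{nS}$ is defined by $p\equiv_{nS}q$ iff $p\lesssim_{nS}q$ and $q\lesssim_{nS}p$; $\equiv_{BS}$ denotes bisimilarity. Logics (with $a\in\mathtt{Act}$): $\mathcal{L}_{1S}$: $\varphi::=\mathbf{tt}\mid\mathbf{ff}\mid\varphi\wedge\varphi\mid\varphi\vee\varphi\mid\langle a\rangle\varphi$; for $n\geq2$, $\mathcal{L}_{nS}$: $\varphi::=\mathbf{tt}\mid\mathbf{ff}\mid\varphi\wedge\varphi\mid\varphi\vee\varphi\mid\langle a\rangle\varphi\mid\neg\psi$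 with $\psi\in\mathcal{L}_{(n-1)S}$; $\mathcal{L}_{BS}$ (Hennessy–Milner logic): $\varphi::=\mathbf{tt}\mid\mathbf{ff}\mid\varphi\wedge\varphi\mid\varphi\vee\varphi\mid\langle a\rangle\varphi\mid[a]\varphi\mid\neg\varphi$. Semantics is standard: $p\models\langle a\rangle\varphi$ iff some $p\xrightarrow{a}q$ has $q\models\varphi$; $p\models[a]\varphi$ iff every $p\xrightarrow{a}q$ has $q\models\varphi$; Boolean connectives are classical. A formula is satisfiable if some process satisfies it. For a logic $\mathcal{L}$, $\mathcal{L}(p)=\{\varphi\in\mathcal{L}\mid p\models\varphi\}$. A formula $\varphi\in\mathcal{L}_X$ is characteristic for a process $p$ modulo $\equiv_X$ iff for every process $q$: $q\models\varphi\Leftrightarrow\mathcal{L}_X(p)=\mathcal{L}_X(q)$. -}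

module Defs where

open import Data.Nat using (ℕ; zero; suc; _≤_)
open import Data.Fin using (Fin)
open import Data.Bool using (Bool; true)
open import Data.List using (List; []; _∷_)
open import Data.Product using (Σ; _×_)
open import Data.Sum using (_⊎_)
open import Data.Unit using (⊤)
open import Data.Empty using (⊥)
open import Relation.Nullary using (¬_)
open import Relation.Binary.PropositionalEquality using (_≡_)
open import Function.Bundles using (_⇔_)
open import Level using () renaming (suc to lsuc; zero to lzero)

module _ (k : ℕ) where

  Act : Set
  Act = Fin (suc k)

  Trans : ℕ → Set
  Trans n = Fin n → Act → Fin n → Bool

  data Path {n : ℕ} (tr : Trans n) : Fin n → List Act → Fin n → Set where
    nil  : ∀ {s} → Path tr s [] s
    cons : ∀ {s a s' t s''} → tr s a s' ≡ true → Path tr s' t s'' → Path tr s (a ∷ t) s''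

  LoopFree : {n : ℕ} → Trans n → Set
  LoopFree {n} tr = ∀ (s : Fin n) (t : List Act) → Path tr s t s → t ≡ []

  record Process : Set where
    constructor proc
    field
      size     : ℕ
      tr       : Trans size
      loopfree : LoopFree tr
      state    : Fin size
  open Process public

  goto : (p : Process) → Fin (size p) → Process
  goto p s' = proc (size p) (tr p) (loopfree p) s'

  Step : (p : Process) → Act → Fin (size p) → Set
  Step p a s' = tr p (state p) a s' ≡ true

  Rel : Set₁
  Rel = Process → Process → Set

  SimF : Rel → Process → Process → Set
  SimF R p q = ∀ (a : Act) (s' : Fin (size p)) → Step p a s' →
    Σ (Fin (size q)) λ t' → Step q a t' × R (goto p s') (goto q t')

  -- The preorders ≲_{nS} as largest relations (union of all post-fixed points).
  -- Index 0 is junk (same as 1) and never used (the statement requires n ≥ 1).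
  ≲S : ℕ → Process → Process → Set₁
  ≲S zero p q = Σ Rel λ R → (∀ p' q' → R p' q' → SimF R p' q') × R p q
  ≲S (suc zero) p q = Σ Rel λ R → (∀ p' q' → R p' q' → SimF R p' q') × R p q
  ≲S (suc (suc n)) p q =
    Σ Rel λ R → (∀ p' q' → R p' q' → SimF R p' q' × ≲S (suc n) q' p') × R p q

  ≡S : ℕ → Process → Process → Set₁
  ≡S n p q = ≲S n p q × ≲S n q p

  ≡BS : Process → Process → Set₁
  ≡BS p q = Σ Rel λ R →
    (∀ p' q' → R p' q' → SimF R p' q' × SimF (λ x y → R y x) q' p') × R p q

  -- The logics L_{nS}; neg : L_{(n-1)S} → L_{nS} for n ≥ 2.
  -- (Index 0 is junk and never used.)
  data LS : ℕ → Set where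
    tt ff : ∀ {n} → LS n
    _∧_ _∨_ : ∀ {n} → LS n → LS n → LS n
    ⟨_⟩_ : ∀ {n} → Act → LS n → LS n
    neg : ∀ {n} → LS (suc n) → LS (suc (suc n))

  data HML : Set where
    tt ff : HML
    _∧_ _∨_ : HML → HML → HML
    ⟨_⟩_ [_]_ : Act → HML → HML
    neg : HML → HML

  satS : ∀ {n} → Process → LS n → Set
  satS p tt = ⊤
  satS p ff = ⊥
  satS p (φ ∧ ψ) = satS p φ × satS p ψ
  satS p (φ ∨ ψ) = satS p φ ⊎ satS p ψ
  satS p (⟨ a ⟩ φ) = Σ (Fin (size p)) λ s' → Step p a s' × satS (goto p s') φ
  satS p (neg ψ) = ¬ satS p ψ

  satBS : Process → HML → Set
  satBS p tt = ⊤
  satBS p ff = ⊥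
  satBS p (φ ∧ ψ) = satBS p φ × satBS p ψ
  satBS p (φ ∨ ψ) = satBS p φ ⊎ satBS p ψ
  satBS p (⟨ a ⟩ φ) = Σ (Fin (size p)) λ s' → Step p a s' × satBS (goto p s') φ
  satBS p ([ a ] φ) = ∀ (s' : Fin (size p)) → Step p a s' → satBS (goto p s') φ
  satBS p (neg φ) = ¬ satBS p φ

data Idx : Set where
  BS : Idx
  nS : (n : ℕ) → 1 ≤ n → Idx

module _ (k : ℕ) where

  Fml : Idx → Set
  Fml BS = HML k
  Fml (nS n _) = LS k n

  _⊨_ : {X : Idx} → Process k → Fml X → Set
  _⊨_ {BS} p φ = satBS k p φ
  _⊨_ {nS n _} p φ = satS k p φ

  Equiv : Idx → Process k → Process k → Set₁
  Equiv BS p q = ≡BS k p q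
  Equiv (nS n _) p q = ≡S k n p q

  SameTheory : Idx → Process k → Process k → Set
  SameTheory X p q = ∀ (ψ : Fml X) → (p ⊨ ψ) ⇔ (q ⊨ ψ)

  Characteristic : (X : Idx) → Fml X → Process k → Set
  Characteristic X φ p = ∀ (q : Process k) → (q ⊨ φ) ⇔ SameTheory X p q

  Satisfiable : (X : Idx) → Fml X → Set
  Satisfiable X φ = Σ (Process k) λ p → p ⊨ φ

-- On finite loop-free processes ≡_X coincides with equality of L_X-theories, so a formula
-- is characteristic exactly when its models form a single ≡_X-class. The hard half of that
-- logical characterisation is proved constructively: loop-freedom bounds the depth of both
-- processes by some d, and the depth-d approximant of the preorder is decided by a finite
-- search that either succeeds, in which case the approximant is already a (nested)
-- simulation, or fails at a transition p -a-> p', from which the formula ⟨a⟩⋀ᵢ φᵢ, with φᵢ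
-- separating p' from the i-th a-successor of q, distinguishes p from q.
module Submission where

open import Defs
open import Data.Nat using (ℕ; zero; suc; _≤_; _⊔_; s≤s)
open import Data.Nat.Properties using (m≤m⊔n; m≤n⊔m)
open import Data.Fin using (Fin; zero; suc)
open import Data.Fin.Induction using (spo-wellFounded)
open import Data.Fin.Properties using (∀-cons)
open import Data.Bool using (true; false; _≟_)
open import Data.List using ([]; _∷_; _++_)
open import Data.Product using (Σ; ∃; ∃₂; _×_; _,_; proj₁; proj₂; swap)
import Data.Product as Product
open import Data.Sum using (_⊎_; inj₁; inj₂)
import Data.Sum as Sum
open import Data.Empty using (⊥; ⊥-elim)
open import Data.Unit using (⊤)
open import Function using (_∘_; const; flip; case_of_)
open import Function.Bundles using (_⇔_; mk⇔; Equivalence)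
open import Function.Properties.Equivalence using () renaming (refl to ⇔-refl; sym to ⇔-sym; trans to ⇔-trans)
open import Induction.WellFounded using (Acc; acc)
open import Relation.Nullary using (¬_; Dec; yes; no)
open import Relation.Binary.Structures using (IsStrictPartialOrder)
open import Relation.Binary.PropositionalEquality using (_≡_; refl)
open import Relation.Binary.PropositionalEquality.Properties using (isEquivalence)

open Equivalence using (to; from)

∀-or-∃ : ∀ {m} {P Q : Fin m → Set} → (∀ i → P i ⊎ Q i) → (∀ i → P i) ⊎ ∃ Q
∀-or-∃ {zero} _ = inj₁ λ ()
∀-or-∃ {suc m} f with f zero | ∀-or-∃ (f ∘ suc)
... | inj₁ p₀ | inj₁ ps = inj₁ (∀-cons p₀ ps)
... | inj₁ _  | inj₂ (i , q) = inj₂ (suc i , q)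
... | inj₂ q₀ | _ = inj₂ (zero , q₀)

∃-or-∀ : ∀ {m} {P Q : Fin m → Set} → (∀ i → P i ⊎ Q i) → ∃ P ⊎ (∀ i → Q i)
∃-or-∀ f = Sum.swap (∀-or-∃ (Sum.swap ∘ f))

common-bound : ∀ {m} {P : ℕ → Fin m → Set} → (∀ {d e} i → d ≤ e → P d i → P e i) →
  (∀ i → ∃ λ d → P d i) → ∃ λ d → ∀ i → P d i
common-bound {zero} mono f = 0 , λ ()
common-bound {suc m} mono f =
  let d₀ , p₀ = f zero
      d , ps = common-bound (mono ∘ suc) (f ∘ suc)
  in d₀ ⊔ d , ∀-cons (mono zero (m≤m⊔n d₀ d) p₀) (λ i → mono (suc i) (m≤n⊔m d₀ d) (ps i))

module _ {k : ℕ} where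

  step? : ∀ p a s → Dec (Step k p a s)
  step? p a s = tr p (state p) a s ≟ true

  Bounded : ℕ → Process k → Set
  Bounded zero p = ⊥
  Bounded (suc d) p = ∀ a s → Step k p a s → Bounded d (goto k p s)

  Bounded-mono : ∀ {d e} p → d ≤ e → Bounded d p → Bounded e p
  Bounded-mono {suc d} {suc e} p (s≤s d≤e) b a s st = Bounded-mono (goto k p s) d≤e (b a s st)

  module _ {n} (T : Trans k n) (lf : LoopFree k T) where

    _⊏_ : Fin n → Fin n → Set
    j ⊏ i = ∃₂ λ a t → Path k T i (a ∷ t) j

    Path-++ : ∀ {i j l t u} → Path k T i t j → Path k T j u l → Path k T i (t ++ u) l
    Path-++ nil ρ = ρ
    Path-++ (cons st π) ρ = cons st (Path-++ π ρ)

    ⊏-isStrictPartialOrder : IsStrictPartialOrder _≡_ _⊏_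
    ⊏-isStrictPartialOrder = record
      { isEquivalence = isEquivalence
      ; irrefl = λ { refl (_ , _ , π) → case lf _ _ π of λ () }
      ; trans = λ { (a , t , π) (b , u , ρ) → b , u ++ a ∷ t , Path-++ ρ π }
      ; <-resp-≈ = (λ { refl j⊏i → j⊏i }) , (λ { refl j⊏i → j⊏i })
      }

    bounded-acc : ∀ s → Acc _⊏_ s → ∃ λ d → Bounded d (proc n T lf s)
    bounded-acc s (acc rs) =
      let d , b = common-bound (λ a d≤e b s′ st → Bounded-mono _ d≤e (b s′ st))
                    (λ a → common-bound (λ s′ d≤e b st → Bounded-mono _ d≤e (b st)) (successor a))
      in suc d , b
      where
      successor : ∀ a s′ → ∃ λ d → T s a s′ ≡ true → Bounded d (proc n T lf s′)
      successor a s′ with T s a s′ in st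
      ... | true = Product.map₂ const (bounded-acc s′ (rs (a , [] , cons st nil)))
      ... | false = 0 , λ ()

  bounded : ∀ p → ∃ λ d → Bounded d p
  bounded (proc n T lf s) = bounded-acc T lf s (spo-wellFounded (⊏-isStrictPartialOrder T lf) s)

  bounded₂ : ∀ p q → ∃ λ d → Bounded d p × Bounded d q
  bounded₂ p q =
    let d , bp = bounded p
        e , bq = bounded q
    in d ⊔ e , Bounded-mono p (m≤m⊔n d e) bp , Bounded-mono q (m≤n⊔m d e) bq

  record ModalLogic : Set₁ where
    field
      Formula : Set
      _⊩_     : Process k → Formula → Set
      ⊤ᶠ      : Formula
      _∧ᶠ_    : Formula → Formula → Formula
      ⟨_⟩ᶠ_   : Act k → Formula → Formula
      ⊩-⊤     : ∀ {p} → p ⊩ ⊤ᶠ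
      ⊩-∧     : ∀ {p φ ψ} → p ⊩ (φ ∧ᶠ ψ) ⇔ (p ⊩ φ × p ⊩ ψ)
      ⊩-⟨⟩    : ∀ {p a φ} → p ⊩ (⟨ a ⟩ᶠ φ) ⇔ (∃ λ s → Step k p a s × goto k p s ⊩ φ)

  LSᵐ : ℕ → ModalLogic
  LSᵐ n = record
    { Formula = LS k n ; _⊩_ = satS k ; ⊤ᶠ = tt ; _∧ᶠ_ = _∧_ ; ⟨_⟩ᶠ_ = ⟨_⟩_
    ; ⊩-⊤ = _ ; ⊩-∧ = ⇔-refl ; ⊩-⟨⟩ = ⇔-refl }

  HMLᵐ : ModalLogic
  HMLᵐ = record
    { Formula = HML k ; _⊩_ = satBS k ; ⊤ᶠ = tt ; _∧ᶠ_ = _∧_ ; ⟨_⟩ᶠ_ = ⟨_⟩_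
    ; ⊩-⊤ = _ ; ⊩-∧ = ⇔-refl ; ⊩-⟨⟩ = ⇔-refl }

  module _ (L : ModalLogic) where
    open ModalLogic L

    ⋀ : ∀ {m} → (Fin m → Formula) → Formula
    ⋀ {zero} φ = ⊤ᶠ
    ⋀ {suc m} φ = φ zero ∧ᶠ ⋀ (φ ∘ suc)

    ⊩-⋀ : ∀ {p m} {φ : Fin m → Formula} → p ⊩ ⋀ φ ⇔ (∀ i → p ⊩ φ i)
    ⊩-⋀ {m = zero} = mk⇔ (λ _ ()) (λ _ → ⊩-⊤)
    ⊩-⋀ {m = suc m} = mk⇔
      (λ h → let h₀ , hs = to ⊩-∧ h in ∀-cons h₀ (to ⊩-⋀ hs))
      (λ h → from ⊩-∧ (h zero , from ⊩-⋀ (h ∘ suc)))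

    Distinguishes : Process k → Process k → Set
    Distinguishes p q = Σ Formula λ φ → p ⊩ φ × ¬ q ⊩ φ

    SimF-or-distinguishes : ∀ {R : Rel k} → (∀ x y → R x y ⊎ Distinguishes x y) →
      ∀ p q → SimF k R p q ⊎ Distinguishes p q
    SimF-or-distinguishes {R} R-or-dist p q =
      Sum.map₂ proj₂ (∀-or-∃ λ a → Sum.map₂ proj₂ (∀-or-∃ λ s → matched-or-distinguishes a s))
      where
      Separated : Act k → Fin (size p) → Fin (size q) → Set
      Separated a s t = Σ Formula λ φ → goto k p s ⊩ φ × (Step k q a t → ¬ goto k q t ⊩ φ)

      matched-or-separated : ∀ a s t → (Step k q a t × R (goto k p s) (goto k q t)) ⊎ Separated a s t
      matched-or-separated a s t with step? q a t | R-or-dist (goto k p s) (goto k q t)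
      ... | yes st | inj₁ r = inj₁ (st , r)
      ... | yes _  | inj₂ (φ , ⊩φ , ⊭φ) = inj₂ (φ , ⊩φ , const ⊭φ)
      ... | no ¬st | _ = inj₂ (⊤ᶠ , ⊩-⊤ , ⊥-elim ∘ ¬st)

      unmatched : ∀ {a s} → Step k p a s → (∀ t → Separated a s t) → Distinguishes p q
      unmatched {a} {s} st sep =
        ⟨ a ⟩ᶠ ⋀ (proj₁ ∘ sep) ,
        from ⊩-⟨⟩ (s , st , from ⊩-⋀ (proj₁ ∘ proj₂ ∘ sep)) ,
        λ h → let t , st′ , h′ = to ⊩-⟨⟩ h in proj₂ (proj₂ (sep t)) st′ (to ⊩-⋀ h′ t)

      matched-or-distinguishes : ∀ a s →
        (Step k p a s → ∃ λ t → Step k q a t × R (goto k p s) (goto k q t)) ⊎ Distinguishes p q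
      matched-or-distinguishes a s with step? p a s
      ... | no ¬st = inj₁ (⊥-elim ∘ ¬st)
      ... | yes st = Sum.map const (unmatched st) (∃-or-∀ (matched-or-separated a s))

  Within : (ℕ → Rel k) → Rel k
  Within A p q = ∃ λ d → Bounded d p × Bounded d q × A d p q

  within-SimF : ∀ A {d p q} → Bounded (suc d) p → Bounded (suc d) q →
    SimF k (A d) p q → SimF k (Within A) p q
  within-SimF A bp bq sim a s st =
    let t , st′ , r = sim a s st in t , st′ , (_ , bp a s st , bq a t st′ , r)

  -- Approx n d is the depth-d approximant of ≲_{(n+1)S}.
  Approx : ℕ → ℕ → Rel k
  Approx n zero p q = ⊤
  Approx zero (suc d) p q = SimF k (Approx zero d) p q
  Approx (suc n) (suc d) p q = SimF k (Approx (suc n) d) p q × Approx n (suc d) q p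

  LS-distinguishes-neg : ∀ {n p q} →
    Distinguishes (LSᵐ (suc n)) q p → Distinguishes (LSᵐ (suc (suc n))) p q
  LS-distinguishes-neg (φ , ⊨φ , ⊭φ) = neg φ , ⊭φ , λ ⊭φ′ → ⊭φ′ ⊨φ

  approx-or-distinguishes : ∀ n d p q → Approx n d p q ⊎ Distinguishes (LSᵐ (suc n)) p q
  approx-or-distinguishes n zero p q = inj₁ _
  approx-or-distinguishes zero (suc d) p q =
    SimF-or-distinguishes (LSᵐ 1) (approx-or-distinguishes zero d) p q
  approx-or-distinguishes (suc n) (suc d) p q
    with SimF-or-distinguishes (LSᵐ (suc (suc n))) (approx-or-distinguishes (suc n) d) p q
       | approx-or-distinguishes n (suc d) q p
  ... | inj₁ sim | inj₁ back = inj₁ (sim , back)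
  ... | inj₂ δ   | _ = inj₂ δ
  ... | inj₁ _   | inj₂ δ = inj₂ (LS-distinguishes-neg δ)

  approx⇒≲S : ∀ n {p q} → Within (Approx n) p q → ≲S k (suc n) p q
  approx⇒≲S zero w = Within (Approx zero) , post , w
    where
    post : ∀ p q → Within (Approx zero) p q → SimF k (Within (Approx zero)) p q
    post p q (suc d , bp , bq , sim) = within-SimF (Approx zero) bp bq sim
  approx⇒≲S (suc n) w = Within (Approx (suc n)) , post , w
    where
    post : ∀ p q → Within (Approx (suc n)) p q →
      SimF k (Within (Approx (suc n))) p q × ≲S k (suc n) q p
    post p q (suc d , bp , bq , sim , back) =
      within-SimF (Approx (suc n)) bp bq sim , approx⇒≲S n (suc d , bq , bp , back)

  ⊆-theory⇒≲S : ∀ n {p q} → (∀ (φ : LS k (suc n)) → satS k p φ → satS k q φ) → ≲S k (suc n) p q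
  ⊆-theory⇒≲S n {p} {q} ⊆ with bounded₂ p q
  ... | d , bp , bq with approx-or-distinguishes n d p q
  ...   | inj₁ approx = approx⇒≲S n (d , bp , bq , approx)
  ...   | inj₂ (φ , ⊨φ , ⊭φ) = ⊥-elim (⊭φ (⊆ φ ⊨φ))

  ApproxBS : ℕ → Rel k
  ApproxBS zero p q = ⊤
  ApproxBS (suc d) p q = SimF k (ApproxBS d) p q × SimF k (flip (ApproxBS d)) q p

  HML-distinguishes-neg : ∀ {p q} → Distinguishes HMLᵐ q p → Distinguishes HMLᵐ p q
  HML-distinguishes-neg (φ , ⊨φ , ⊭φ) = neg φ , ⊭φ , λ ⊭φ′ → ⊭φ′ ⊨φ

  approxBS-or-distinguishes : ∀ d p q → ApproxBS d p q ⊎ Distinguishes HMLᵐ p q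
  approxBS-or-distinguishes zero p q = inj₁ _
  approxBS-or-distinguishes (suc d) p q
    with SimF-or-distinguishes HMLᵐ (approxBS-or-distinguishes d) p q
       | SimF-or-distinguishes HMLᵐ
           (λ x y → Sum.map₂ HML-distinguishes-neg (approxBS-or-distinguishes d y x)) q p
  ... | inj₁ sim | inj₁ back = inj₁ (sim , back)
  ... | inj₂ δ   | _ = inj₂ δ
  ... | inj₁ _   | inj₂ δ = inj₂ (HML-distinguishes-neg δ)

  approxBS⇒≡BS : ∀ {p q} → Within ApproxBS p q → ≡BS k p q
  approxBS⇒≡BS w = Within ApproxBS , post , w
    where
    post : ∀ p q → Within ApproxBS p q →
      SimF k (Within ApproxBS) p q × SimF k (flip (Within ApproxBS)) q p
    post p q (suc d , bp , bq , sim , back) =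
      within-SimF ApproxBS bp bq sim ,
      λ a t st → let s , st′ , r = back a t st in s , st′ , (d , bp a s st′ , bq a t st , r)

  ⊆-theory⇒≡BS : ∀ {p q} → (∀ φ → satBS k p φ → satBS k q φ) → ≡BS k p q
  ⊆-theory⇒≡BS {p} {q} ⊆ with bounded₂ p q
  ... | d , bp , bq with approxBS-or-distinguishes d p q
  ...   | inj₁ approx = approxBS⇒≡BS (d , bp , bq , approx)
  ...   | inj₂ (φ , ⊨φ , ⊭φ) = ⊥-elim (⊭φ (⊆ φ ⊨φ))

  NegationsReflected : ℕ → Rel k → Set
  NegationsReflected zero R = ⊤
  NegationsReflected (suc n) R = ∀ p q → R p q → (ψ : LS k (suc n)) → satS k q ψ → satS k p ψ

  preserves-LS : ∀ n (R : Rel k) → (∀ p q → R p q → SimF k R p q) → NegationsReflected n R →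
    ∀ {p q} → R p q → (φ : LS k (suc n)) → satS k p φ → satS k q φ
  preserves-LS n R sim reflect r tt _ = _
  preserves-LS n R sim reflect r (φ ∧ ψ) (⊨φ , ⊨ψ) =
    preserves-LS n R sim reflect r φ ⊨φ , preserves-LS n R sim reflect r ψ ⊨ψ
  preserves-LS n R sim reflect r (φ ∨ ψ) =
    Sum.map (preserves-LS n R sim reflect r φ) (preserves-LS n R sim reflect r ψ)
  preserves-LS n R sim reflect {p} {q} r (⟨ a ⟩ φ) (s , st , ⊨φ) =
    let t , st′ , r′ = sim p q r a s st in t , st′ , preserves-LS n R sim reflect r′ φ ⊨φ
  preserves-LS (suc n) R sim reflect {p} {q} r (neg ψ) ⊭ψ ⊨ψ = ⊭ψ (reflect p q r ψ ⊨ψ)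

  ≲S⇒⊆-theory : ∀ n {p q} → ≲S k (suc n) p q → ∀ (φ : LS k (suc n)) → satS k p φ → satS k q φ
  ≲S⇒⊆-theory zero (R , sim , r) = preserves-LS zero R sim _ r
  ≲S⇒⊆-theory (suc n) (R , post , r) =
    preserves-LS (suc n) R (λ p q → proj₁ ∘ post p q) (λ p q → ≲S⇒⊆-theory n ∘ proj₂ ∘ post p q) r

  IsBisimulation : Rel k → Set
  IsBisimulation R = ∀ p q → R p q → SimF k R p q × SimF k (flip R) q p

  flip-IsBisimulation : ∀ {R} → IsBisimulation R → IsBisimulation (flip R)
  flip-IsBisimulation bisim p q = swap ∘ bisim q p

  preserves-HML : ∀ (R : Rel k) → IsBisimulation R →
    ∀ {p q} → R p q → ∀ φ → satBS k p φ → satBS k q φ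
  preserves-HML R bisim r tt _ = _
  preserves-HML R bisim r (φ ∧ ψ) (⊨φ , ⊨ψ) =
    preserves-HML R bisim r φ ⊨φ , preserves-HML R bisim r ψ ⊨ψ
  preserves-HML R bisim r (φ ∨ ψ) = Sum.map (preserves-HML R bisim r φ) (preserves-HML R bisim r ψ)
  preserves-HML R bisim {p} {q} r (⟨ a ⟩ φ) (s , st , ⊨φ) =
    let t , st′ , r′ = proj₁ (bisim p q r) a s st in t , st′ , preserves-HML R bisim r′ φ ⊨φ
  preserves-HML R bisim {p} {q} r ([ a ] φ) ⊨φ t st =
    let s , st′ , r′ = proj₂ (bisim p q r) a t st in preserves-HML R bisim r′ φ (⊨φ s st′)
  preserves-HML R bisim r (neg φ) ⊭φ ⊨φ =
    ⊭φ (preserves-HML (flip R) (flip-IsBisimulation bisim) r φ ⊨φ)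

  Equiv⇔SameTheory : ∀ X p q → Equiv k X p q ⇔ SameTheory k X p q
  Equiv⇔SameTheory BS p q = mk⇔
    (λ { (R , bisim , r) φ → mk⇔ (preserves-HML R bisim r φ)
                                 (preserves-HML (flip R) (flip-IsBisimulation bisim) r φ) })
    (λ same → ⊆-theory⇒≡BS (to ∘ same))
  Equiv⇔SameTheory (nS (suc n) _) p q = mk⇔
    (λ { (p≲q , q≲p) φ → mk⇔ (≲S⇒⊆-theory n p≲q φ) (≲S⇒⊆-theory n q≲p φ) })
    (λ same → ⊆-theory⇒≲S n (to ∘ same) , ⊆-theory⇒≲S n (from ∘ same))

proposition11 : (k : ℕ) (X : Idx) (φ : Fml k X) →
    (Σ (Process k) λ p → Characteristic k X φ p) ⇔
    (Satisfiable k X φ ×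
      (∀ (p q : Process k) → _⊨_ k p φ → _⊨_ k q φ → Equiv k X p q))
proposition11 k X φ = mk⇔ characteristic⇒unique unique⇒characteristic
  where
  Unique : Set₁
  Unique = Satisfiable k X φ × (∀ p q → _⊨_ k p φ → _⊨_ k q φ → Equiv k X p q)

  characteristic⇒unique : (Σ (Process k) λ p → Characteristic k X φ p) → Unique
  characteristic⇒unique (p , χ) =
    (p , from (χ p) (λ _ → ⇔-refl)) ,
    λ q r ⊨q ⊨r → from (Equiv⇔SameTheory X q r)
                       (λ ψ → ⇔-trans (⇔-sym (to (χ q) ⊨q ψ)) (to (χ r) ⊨r ψ))
  unique⇒characteristic : Unique → Σ (Process k) λ p → Characteristic k X φ p
  unique⇒characteristic ((p , ⊨p) , unique) =
    p , λ q → mk⇔ (λ ⊨q → to (Equiv⇔SameTheory X p q) (unique p q ⊨p ⊨q))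
                  (λ same → to (same φ) ⊨p)
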